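{- Let $G$ be a finite simple graph and $X_0,X_1,\dots,X_{k+1}$ a nice path decomposition of $G$. For $0\le i\le j\le k+1$ let $X_i^j=\bigcup_{\tau=i}^{j}X_\tau$ and $G(i,j)=G[X_i^j]$. Let $0\le t<z\le k+1$. If $X_t\cup X_{z-1}$ is a zero forcing set for $G(t,z-1)$ but $X_t\cup X_z$ is not a zero forcing set for $G(t,z)$, then $X_z\subset X_{z-1}$.
   Context: Zero forcing: a blue vertex $u$ may force a white neighbour $v$ if $v$ is the only white vertex in $N[u]$; a zero forcing set of a graph is an initial blue set from which all vertices of that graph eventually become blue. A nice path decomposition of $G=(V,E)$ is a sequence of subsets $X_0,X_1,\dots,X_k,X_{k+1}\subseteq V$ such that: (D1) for each edge $uv\in E$ there is $1\le i\le k$ with $\{u,v\}\subseteq X_i$; (D2) for each $v\in V$ and $1\le i<j\le k$, if $v\in X_i\cap X_j$ then $v\in X_s$ for all $i\le s\le j$; (D3) $X_0=X_{k+1}=\emptyset$ and $X_i\neq\emptyset$ for $1\le i\le k$; (D4) for each $0\le i\le k$, either $X_{i+1}=X_i\cup\{v\}$ for some $v\in V\setminus X_i$, or $X_{i+1}=X_i\setminus\{v\}$ for some $v\in X_i$. -}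

module Defs where

open import Data.Nat using (ℕ; zero; suc; _+_; _∸_; _≤_; _<_)
open import Data.Fin using (Fin)
open import Data.Fin.Subset using (Subset; _∈_; _∉_; _⊆_; _∪_; _-_; ⁅_⁆) renaming (⊥ to ∅)
open import Data.Product using (Σ; ∃; ∃-syntax; _×_)
open import Data.Sum using (_⊎_)
open import Relation.Nullary using (¬_)
open import Relation.Binary.PropositionalEquality using (_≡_)

record SimpleGraph (n : ℕ) : Set₁ where
  field
    Adj   : Fin n → Fin n → Set
    sym   : ∀ {u v} → Adj u v → Adj v u
    irrefl : ∀ {u} → ¬ Adj u u
open SimpleGraph public

module _ {n : ℕ} (G : SimpleGraph n) (W : Subset n) where

  Forces : Subset n → Fin n → Fin n → Set
  Forces B u v =
    u ∈ W × u ∈ B × v ∈ W × v ∉ B × Adj G u v ×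
    (∀ w → w ∈ W → Adj G u w → w ∉ B → w ≡ v)

  data ForcingSeq : Subset n → Subset n → Set where
    done : ∀ {B} → ForcingSeq B B
    step : ∀ {B C} u v → Forces B u v → ForcingSeq (B ∪ ⁅ v ⁆) C → ForcingSeq B C

  IsZeroForcingSet : Subset n → Set
  IsZeroForcingSet S = S ⊆ W × ∃[ C ] (ForcingSeq S C × W ⊆ C)

seg : {n : ℕ} → (ℕ → Subset n) → ℕ → ℕ → Subset n
seg X i zero    = X i
seg X i (suc d) = seg X i d ∪ X (i + suc d)

-- X_i^j = ⋃_{τ=i}^{j} X_τ   (used for i ≤ j)
Union[_,_] : {n : ℕ} → ℕ → ℕ → (ℕ → Subset n) → Subset n
Union[ i , j ] X = seg X i (j ∸ i)

-- Nice path decomposition X_0, …, X_{k+1} of G (bags beyond k+1 are irrelevant).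
record NicePathDecomposition {n : ℕ} (G : SimpleGraph n) (k : ℕ) (X : ℕ → Subset n) : Set where
  field
    D1 : ∀ u v → Adj G u v → ∃[ i ] (1 ≤ i × i ≤ k × u ∈ X i × v ∈ X i)
    D2 : ∀ v i j s → 1 ≤ i → i < j → j ≤ k → v ∈ X i → v ∈ X j →
         i ≤ s → s ≤ j → v ∈ X s
    D3-first : X 0 ≡ ∅
    D3-last  : X (suc k) ≡ ∅
    D3-nonempty : ∀ i → 1 ≤ i → i ≤ k → ∃[ v ] (v ∈ X i)
    D4 : ∀ i → i ≤ k →
         (∃[ v ] (v ∉ X i × X (suc i) ≡ X i ∪ ⁅ v ⁆)) ⊎
         (∃[ v ] (v ∈ X i × X (suc i) ≡ X i - v))

-- Consecutive bags of a nice path decomposition differ by one vertex. If X_z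
-- loses a vertex, X_z ⊂ X_{z-1}. Otherwise X_{z-1} ⊆ X_z, so G(t,z) adds to
-- G(t,z-1) only vertices of X_z, all of which start blue from X_t ∪ X_z; every
-- force of a forcing sequence for G(t,z-1) is then still legal in G(t,z), and
-- X_t ∪ X_z would be a zero forcing set of G(t,z).
module Submission where

open import Defs
open import Data.Nat using (ℕ; _∸_; _<_; _≤_; suc; _+_; s≤s)
open import Data.Nat.Properties using (+-suc; +-∸-assoc; m+[n∸m]≡n)
open import Data.Fin using (Fin)
open import Data.Fin.Subset using (Subset; _∪_; _⊂_; _⊆_; _∈_; _∉_)
open import Data.Fin.Subset.Properties
  using (_∈?_; p⊆p∪q; q⊆p∪q; x∈p∪q⁻; x∈⁅y⁆⇒x≡y; x∈p⇒p-x⊂p; ⊆-refl; ⊆-trans)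
open import Data.Product using (∃-syntax; _×_; _,_)
open import Data.Sum using (inj₁; inj₂; [_,_])
open import Relation.Nullary using (¬_; yes; no; contradiction)
open import Relation.Binary.PropositionalEquality
  using (_≡_; trans; cong; subst; module ≡-Reasoning) renaming (sym to ≡-sym)

∪-⊆ : ∀ {n} {p q r : Subset n} → p ⊆ r → q ⊆ r → p ∪ q ⊆ r
∪-⊆ p⊆r q⊆r x = [ p⊆r , q⊆r ] (x∈p∪q⁻ _ _ x)

∪-mono-⊆ : ∀ {n} {p q r s : Subset n} → p ⊆ r → q ⊆ s → p ∪ q ⊆ r ∪ s
∪-mono-⊆ p⊆r q⊆s = ∪-⊆ (⊆-trans p⊆r (p⊆p∪q _)) (⊆-trans q⊆s (q⊆p∪q _ _))

module _ {n : ℕ} (G : SimpleGraph n) where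

  ForcingSeq-⊆ : ∀ {W B C} → ForcingSeq G W B C → B ⊆ C
  ForcingSeq-⊆ done            = ⊆-refl
  ForcingSeq-⊆ (step _ _ _ fs) = ⊆-trans (p⊆p∪q _) (ForcingSeq-⊆ fs)

  private
    white-in : ∀ {W W' B} {w : Fin n} → W' ⊆ W ∪ B → w ∈ W' → w ∉ B → w ∈ W
    white-in W'⊆W∪B w∈W' w∉B =
      [ (λ w∈W → w∈W) , (λ w∈B → contradiction w∈B w∉B) ] (x∈p∪q⁻ _ _ (W'⊆W∪B w∈W'))

  Forces-lift : ∀ {W W' B B' u v} → W ⊆ W' → B ⊆ B' → W' ⊆ W ∪ B' → v ∉ B' →
                Forces G W B u v → Forces G W' B' u v
  Forces-lift W⊆W' B⊆B' W'⊆W∪B' v∉B' (u∈W , u∈B , v∈W , _ , uv , unique) =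
    W⊆W' u∈W , B⊆B' u∈B , W⊆W' v∈W , v∉B' , uv ,
    λ w w∈W' uw w∉B' → unique w (white-in W'⊆W∪B' w∈W' w∉B') uw (λ w∈B → w∉B' (B⊆B' w∈B))

  -- Forces whose target is already blue in B' are skipped.
  ForcingSeq-lift : ∀ {W W' B B' C} → W ⊆ W' → B ⊆ B' → W' ⊆ W ∪ B' →
                    ForcingSeq G W B C → ∃[ C' ] (ForcingSeq G W' B' C' × C ⊆ C')
  ForcingSeq-lift {B' = B'} _ B⊆B' _ done = B' , done , B⊆B'
  ForcingSeq-lift {B' = B'} W⊆W' B⊆B' W'⊆W∪B' (step u v force fs)
    with v ∈? B'
  ... | yes v∈B' =
    ForcingSeq-lift W⊆W' (∪-⊆ B⊆B' (λ x → subst (_∈ B') (≡-sym (x∈⁅y⁆⇒x≡y _ x)) v∈B')) W'⊆W∪B' fs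
  ... | no v∉B'
    with ForcingSeq-lift W⊆W' (∪-mono-⊆ B⊆B' ⊆-refl)
                         (⊆-trans W'⊆W∪B' (∪-mono-⊆ ⊆-refl (p⊆p∪q _))) fs
  ... | C' , fs' , C⊆C' =
    C' , step u v (Forces-lift W⊆W' B⊆B' W'⊆W∪B' v∉B' force) fs' , C⊆C'

  IsZeroForcingSet-lift : ∀ {W W' S S'} → W ⊆ W' → S ⊆ S' → S' ⊆ W' → W' ⊆ W ∪ S' →
                          IsZeroForcingSet G W S → IsZeroForcingSet G W' S'
  IsZeroForcingSet-lift W⊆W' S⊆S' S'⊆W' W'⊆W∪S' (_ , C , fs , W⊆C)
    with ForcingSeq-lift W⊆W' S⊆S' W'⊆W∪S' fs
  ... | C' , fs' , C⊆C' =
    S'⊆W' , C' , fs' , ⊆-trans W'⊆W∪S' (∪-⊆ (⊆-trans W⊆C C⊆C') (ForcingSeq-⊆ fs'))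

module _ {n : ℕ} (X : ℕ → Subset n) where

  head⊆seg : ∀ i d → X i ⊆ seg X i d
  head⊆seg i 0       = ⊆-refl
  head⊆seg i (suc d) = ⊆-trans (head⊆seg i d) (p⊆p∪q _)

  Union-suc : ∀ {i j} → i ≤ j → Union[ i , suc j ] X ≡ Union[ i , j ] X ∪ X (suc j)
  Union-suc {i} {j} i≤j = begin
    seg X i (suc j ∸ i)                    ≡⟨ cong (seg X i) (+-∸-assoc 1 i≤j) ⟩
    seg X i (j ∸ i) ∪ X (i + suc (j ∸ i))  ≡⟨ cong (λ m → seg X i (j ∸ i) ∪ X m) i+suc[j∸i]≡suc[j] ⟩
    seg X i (j ∸ i) ∪ X (suc j)            ∎
    where
    open ≡-Reasoning
    i+suc[j∸i]≡suc[j] : i + suc (j ∸ i) ≡ suc j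
    i+suc[j∸i]≡suc[j] = trans (+-suc i (j ∸ i)) (cong suc (m+[n∸m]≡n i≤j))

zeroForcing-step : ∀ {n} (G : SimpleGraph n) (X : ℕ → Subset n) {t j} → t ≤ j →
  X j ⊆ X (suc j) →
  IsZeroForcingSet G (Union[ t , j ] X) (X t ∪ X j) →
  IsZeroForcingSet G (Union[ t , suc j ] X) (X t ∪ X (suc j))
zeroForcing-step G X {t} {j} t≤j Xj⊆Xsj
  rewrite Union-suc X t≤j =
  IsZeroForcingSet-lift G (p⊆p∪q _) (∪-mono-⊆ ⊆-refl Xj⊆Xsj)
    (∪-mono-⊆ (head⊆seg X t (j ∸ t)) ⊆-refl) (∪-mono-⊆ ⊆-refl (q⊆p∪q (X t) _))

lemma4p7 : (n : ℕ) (G : SimpleGraph n) (k : ℕ) (X : ℕ → Subset n) →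
    NicePathDecomposition G k X →
    (t z : ℕ) → t < z → z ≤ suc k →
    IsZeroForcingSet G (Union[ t , z ∸ 1 ] X) (X t ∪ X (z ∸ 1)) →
    ¬ IsZeroForcingSet G (Union[ t , z ] X) (X t ∪ X z) →
    X z ⊂ X (z ∸ 1)
lemma4p7 _ G _ X P t (suc j) (s≤s t≤j) (s≤s j≤k) zfs ¬zfs
  with NicePathDecomposition.D4 P j j≤k
... | inj₂ (v , v∈Xj , Xsj≡Xj-v) rewrite Xsj≡Xj-v = x∈p⇒p-x⊂p v∈Xj
... | inj₁ (v , _ , Xsj≡Xj∪v) =
  contradiction (zeroForcing-step G X t≤j Xj⊆Xsj zfs) ¬zfs
  where
  Xj⊆Xsj : X j ⊆ X (suc j)
  Xj⊆Xsj x rewrite Xsj≡Xj∪v = p⊆p∪q _ x
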